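{- Let $a\ge 2$ be even and let $c$ be odd. If $0<c<\frac a2$, then $U=\{(a,-a),(c,-c)\}$ is avoidable in $\mathcal{B}$. If $c=\frac a2$, then $U=\{(a,-a),(\frac a2,-\frac a2),(0,0)\}$ is avoidable in $\mathcal{B}$.
   Context: The bicyclic inverse semigroup is $\mathcal{B}=\{(a,b)\in\mathbb{Z}\times\mathbb{Z}\mid a\ge 0,\ a+b\ge 0\}$ with multiplication $(a,b)(c,d)=(\max\{c+d,a\}-d,\ b+d)$. A subset $U\subseteq\mathcal{B}$ is avoidable if $\mathcal{B}$ can be partitioned into two sets $A$ and $B$ such that no element of $U$ is a product $st$ of two distinct elements $s\ne t$ both in $A$ or both in $B$. -}

module Defs where

open import Data.Integer using (ℤ; +_; _+_; _-_; -_; _≤_; _⊔_)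
open import Data.Product using (_×_; _,_; Σ; ∃)
open import Data.Bool using (Bool)
open import Relation.Binary.PropositionalEquality using (_≡_)
open import Relation.Nullary using (¬_)

-- Membership in the bicyclic inverse semigroup B ⊆ ℤ × ℤ:
-- (a , b) ∈ B iff a ≥ 0 and a + b ≥ 0.
InB : ℤ × ℤ → Set
InB (a , b) = (+ 0 ≤ a) × (+ 0 ≤ a + b)

_·_ : ℤ × ℤ → ℤ × ℤ → ℤ × ℤ
(a , b) · (c , d) = (((c + d) ⊔ a) - d , b + d)

-- A subset U of B (given as a predicate) is avoidable if B can be partitioned
-- into two sets A and B (encoded by a colouring χ : ℤ × ℤ → Bool, whose values
-- outside B are irrelevant) such that no element of U is a product s·t of two
-- distinct elements s ≠ t of B lying in the same part.
Avoidable : (ℤ × ℤ → Set) → Set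
Avoidable U =
  Σ (ℤ × ℤ → Bool) λ χ →
    ∀ s t → InB s → InB t → ¬ (s ≡ t) → χ s ≡ χ t → ¬ U (s · t)

-- If s · t = (n , -n) in B, then s = (A , -A) is itself idempotent and
-- t = (X , A - n) with X ≤ n; t is an idempotent exactly when X + A = n.  So a
-- colouring of B is built from a colouring F of ℕ and a shift d: idempotents
-- (a , -a) get F a, other elements (a , b) get ¬ F (b + d).  Such a colouring
-- avoids (n , -n) as soon as n + p = d, F gives distinct numbers with sum n
-- different colours, and F is p-periodic on the positive integers.

module Submission where

open import Defs
open import Data.Nat using (ℕ; _<_; _≤_; _*_; suc)
open import Data.Integer using (ℤ; +_; -_)
open import Data.Product using (_×_; _,_; ∃)
open import Data.Sum using (_⊎_)
open import Relation.Binary.PropositionalEquality using (_≡_)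

open import Data.Nat using (zero; _+_; _∸_; z≤n; s≤s; NonZero; >-nonZero; _<?_; _≤?_)
import Data.Nat.Properties as ℕ
open import Data.Nat.DivMod using (_%_; [m+n]%n≡m%n; m<n⇒m%n≡m)
import Data.Integer as ℤ
import Data.Integer.Properties as ℤ
open import Data.Integer.Tactic.RingSolver using (solve-∀)
open import Data.Bool using (Bool; true; false; not; _xor_; if_then_else_)
open import Data.Bool.Properties using (not-distribˡ-xor; xor-same; not-¬)
open import Data.Empty using (⊥-elim)
open import Data.Product using (Σ; proj₁; proj₂)
open import Data.Sum using (inj₁; inj₂)
open import Relation.Nullary using (¬_; does; yes; no)
open import Relation.Nullary.Decidable using (dec-true; dec-false)
open import Relation.Binary.Definitions using (tri<; tri≈; tri>)
open import Relation.Binary.PropositionalEquality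
  using (_≢_; refl; sym; trans; cong; cong₂; subst; subst₂; module ≡-Reasoning)

par : ℕ → Bool
par zero    = false
par (suc n) = not (par n)

par-+ : ∀ a b → par (a + b) ≡ par a xor par b
par-+ zero    b = refl
par-+ (suc a) b = trans (cong not (par-+ a b)) (not-distribˡ-xor (par a) (par b))

-- The theorem gives odd c in the form 2m + 1.
par-odd : ∀ m → par (suc (2 * m)) ≡ true
par-odd m = cong not (trans (par-+ m (m + 0))
                       (trans (cong (λ n → par m xor par n) (ℕ.+-identityʳ m)) (xor-same (par m))))

odd-sum-splits : ∀ a b → par (a + b) ≡ true → par a ≢ par b
odd-sum-splits a b odd same = false≢true (begin
  false             ≡⟨ sym (xor-same (par a)) ⟩
  par a xor par a   ≡⟨ cong (par a xor_) same ⟩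
  par a xor par b   ≡⟨ sym (par-+ a b) ⟩
  par (a + b)       ≡⟨ odd ⟩
  true              ∎)
  where
  open ≡-Reasoning
  false≢true : false ≢ true
  false≢true ()

record Avoids (χ : ℤ × ℤ → Bool) (U : ℤ × ℤ → Set) : Set where
  field
    avoids : ∀ s t → InB s → InB t → ¬ (s ≡ t) → χ s ≡ χ t → ¬ U (s · t)
open Avoids

avoidable : ∀ {U} χ → Avoids χ U → Avoidable U
avoidable χ χ-avoids = χ , avoids χ-avoids

avoids-∪ : ∀ {χ U V} → Avoids χ U → Avoids χ V → Avoids χ (λ u → U u ⊎ V u)
avoids (avoids-∪ avoidsU avoidsV) s t s∈B t∈B s≢t same (inj₁ inU) = avoids avoidsU s t s∈B t∈B s≢t same inU
avoids (avoids-∪ avoidsU avoidsV) s t s∈B t∈B s≢t same (inj₂ inV) = avoids avoidsV s t s∈B t∈B s≢t same inV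

+-cancelʳ-≤ : ∀ i j k → i ℤ.+ k ℤ.≤ j ℤ.+ k → i ℤ.≤ j
+-cancelʳ-≤ i j k le = subst₂ ℤ._≤_ (add-sub i k) (add-sub j k) (ℤ.+-monoˡ-≤ (ℤ.- k) le)
  where
  add-sub : ∀ i k → i ℤ.+ k ℤ.- k ≡ i
  add-sub = solve-∀

idempotent-factors : ∀ n s t → InB s → InB t → s · t ≡ (+ n , - (+ n)) →
  Σ ℕ λ A → Σ ℕ λ X → s ≡ (+ A , - (+ A)) × t ≡ (+ X , + A ℤ.- + n) × X ≤ n
idempotent-factors n (+ A , b) (+ X , y) (_ , 0≤A+b) _ st≡n =
  A , X , cong (+ A ,_) b≡-A , cong (+ X ,_) y≡A-n , ℤ.drop‿+≤+ X≤n
  where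
  open ≡-Reasoning
  top : ℤ
  top = (+ X ℤ.+ y) ℤ.⊔ + A

  top≡n+y : top ≡ + n ℤ.+ y
  top≡n+y = trans (sub-add top y) (cong (ℤ._+ y) (cong proj₁ st≡n))
    where
    sub-add : ∀ i j → i ≡ (i ℤ.- j) ℤ.+ j
    sub-add = solve-∀

  -b≡n+y : ℤ.- b ≡ + n ℤ.+ y
  -b≡n+y = begin
    ℤ.- b                      ≡⟨ neg-via b y ⟩
    ℤ.- (b ℤ.+ y) ℤ.+ y        ≡⟨ cong (λ i → ℤ.- i ℤ.+ y) (cong proj₂ st≡n) ⟩
    ℤ.- (ℤ.- (+ n)) ℤ.+ y      ≡⟨ cong (ℤ._+ y) (ℤ.neg-involutive (+ n)) ⟩
    + n ℤ.+ y                  ∎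
    where
    neg-via : ∀ i j → ℤ.- i ≡ ℤ.- (i ℤ.+ j) ℤ.+ j
    neg-via = solve-∀

  -- A ≤ top = -b ≤ A, so b = -A.
  A≡-b : + A ≡ ℤ.- b
  A≡-b = ℤ.≤-antisym A≤-b -b≤A
    where
    A≤-b : + A ℤ.≤ ℤ.- b
    A≤-b = subst (+ A ℤ.≤_) (trans top≡n+y (sym -b≡n+y)) (ℤ.i≤j⊔i (+ X ℤ.+ y) (+ A))
    -b≤A : ℤ.- b ℤ.≤ + A
    -b≤A = ℤ.0≤i-j⇒j≤i (subst (+ 0 ℤ.≤_) (cong (λ i → + A ℤ.+ i) (sym (ℤ.neg-involutive b))) 0≤A+b)

  b≡-A : b ≡ ℤ.- (+ A)
  b≡-A = trans (sym (ℤ.neg-involutive b)) (cong ℤ.-_ (sym A≡-b))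

  y≡A-n : y ≡ + A ℤ.- + n
  y≡A-n = begin
    y                              ≡⟨ sum-sub b y ⟩
    (b ℤ.+ y) ℤ.- b                ≡⟨ cong₂ ℤ._-_ (cong proj₂ st≡n) b≡-A ⟩
    ℤ.- (+ n) ℤ.- ℤ.- (+ A)        ≡⟨ swap (+ n) (+ A) ⟩
    + A ℤ.- + n                    ∎
    where
    sum-sub : ∀ i j → j ≡ (i ℤ.+ j) ℤ.- i
    sum-sub = solve-∀
    swap : ∀ i j → ℤ.- i ℤ.- ℤ.- j ≡ j ℤ.- i
    swap = solve-∀

  X≤n : + X ℤ.≤ + n
  X≤n = +-cancelʳ-≤ (+ X) (+ n) y
          (subst (+ X ℤ.+ y ℤ.≤_) top≡n+y (ℤ.i≤i⊔j (+ X ℤ.+ y) (+ A)))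

Separates : (ℕ → Bool) → ℕ → Set
Separates F n = ∀ a x → a + x ≡ n → a ≢ x → F a ≢ F x

Periodic : (ℕ → Bool) → ℕ → Set
Periodic F p = ∀ m → F (suc m + p) ≡ F (suc m)

separates-ordered : ∀ F n → (∀ a x → a < x → a + x ≡ n → F a ≢ F x) → Separates F n
separates-ordered F n ordered a x a+x≡n a≢x with ℕ.<-cmp a x
... | tri< a<x _ _ = ordered a x a<x a+x≡n
... | tri≈ _ a≡x _ = λ _ → a≢x a≡x
... | tri> _ _ x<a = λ Fa≡Fx → ordered x a x<a (trans (ℕ.+-comm x a) a+x≡n) (sym Fa≡Fx)

separates-zero : ∀ F → Separates F 0
separates-zero F zero zero _ 0≢0 = λ _ → 0≢0 refl

periodic-zero : ∀ F → Periodic F 0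
periodic-zero F m = cong F (ℕ.+-identityʳ (suc m))

periodic-+ : ∀ F p q → Periodic F p → Periodic F q → Periodic F (p + q)
periodic-+ F p q per-p per-q m = begin
  F (suc m + (p + q))   ≡⟨ cong F (sym (ℕ.+-assoc (suc m) p q)) ⟩
  F (suc (m + p) + q)   ≡⟨ per-q (m + p) ⟩
  F (suc m + p)         ≡⟨ per-p m ⟩
  F (suc m)             ∎
  where open ≡-Reasoning

periodic-at : ∀ F p → Periodic F p → ∀ {A} → 1 ≤ A → F (A + p) ≡ F A
periodic-at F p periodic {suc A} _ = periodic A

offset-bound : ∀ X A n → + 0 ℤ.≤ + X ℤ.+ (+ A ℤ.- + n) → n ≤ X + A
offset-bound X A n 0≤sum = ℤ.drop‿+≤+ (subst (+ n ℤ.≤_) (sym (ℤ.pos-+ X A))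
  (ℤ.0≤i-j⇒j≤i (subst (+ 0 ℤ.≤_) (regroup (+ X) (+ A) (+ n)) 0≤sum)))
  where
  regroup : ∀ x a m → x ℤ.+ (a ℤ.- m) ≡ x ℤ.+ a ℤ.- m
  regroup = solve-∀

offset : ∀ X A n e → n + e ≡ X + A → + A ℤ.- + n ≡ + e ℤ.- + X
offset X A n e n+e≡X+A = begin
  + A ℤ.- + n                      ≡⟨ regroup (+ X) (+ A) (+ n) ⟩
  (+ X ℤ.+ + A) ℤ.- + n ℤ.- + X    ≡⟨ cong (λ i → i ℤ.- + n ℤ.- + X) (sym (ℤ.pos-+ X A)) ⟩
  + (X + A) ℤ.- + n ℤ.- + X        ≡⟨ cong (λ i → + i ℤ.- + n ℤ.- + X) (sym n+e≡X+A) ⟩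
  + (n + e) ℤ.- + n ℤ.- + X        ≡⟨ cong (λ i → i ℤ.- + n ℤ.- + X) (ℤ.pos-+ n e) ⟩
  (+ n ℤ.+ + e) ℤ.- + n ℤ.- + X    ≡⟨ cancel (+ n) (+ e) (+ X) ⟩
  + e ℤ.- + X                      ∎
  where
  open ≡-Reasoning
  regroup : ∀ x a m → a ℤ.- m ≡ (x ℤ.+ a) ℤ.- m ℤ.- x
  regroup = solve-∀
  cancel : ∀ m e x → (m ℤ.+ e) ℤ.- m ℤ.- x ≡ e ℤ.- x
  cancel = solve-∀

shift : ∀ A n p → + A ℤ.- + n ℤ.+ + (n + p) ≡ + (A + p)
shift A n p = begin
  + A ℤ.- + n ℤ.+ + (n + p)          ≡⟨ cong (λ i → + A ℤ.- + n ℤ.+ i) (ℤ.pos-+ n p) ⟩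
  + A ℤ.- + n ℤ.+ (+ n ℤ.+ + p)      ≡⟨ cancel (+ A) (+ n) (+ p) ⟩
  + A ℤ.+ + p                        ≡⟨ sym (ℤ.pos-+ A p) ⟩
  + (A + p)                          ∎
  where
  open ≡-Reasoning
  cancel : ∀ a m q → a ℤ.- m ℤ.+ (m ℤ.+ q) ≡ a ℤ.+ q
  cancel = solve-∀

excess⇒positive : ∀ {X n j} A → X ≤ n → n + suc j ≡ X + A → 1 ≤ A
excess⇒positive (suc _) _ _ = s≤s z≤n
excess⇒positive {X} {n} zero X≤n n+e≡X+0 =
  ⊥-elim (ℕ.<⇒≱ (ℕ.m<m+n n (s≤s z≤n)) (subst (_≤ n) (trans (sym (ℕ.+-identityʳ X)) (sym n+e≡X+0)) X≤n))

module Lift (F : ℕ → Bool) (d : ℕ) where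

  -- Colour by the coordinate sum; a negative sum never occurs in B.
  colourBy : ℤ → ℤ × ℤ → Bool
  colourBy (+ zero)    (a , b) = F ℤ.∣ a ∣
  colourBy ℤ.+[1+ _ ]  (a , b) = not (F ℤ.∣ b ℤ.+ + d ∣)
  colourBy ℤ.-[1+ _ ]  _       = false

  χ : ℤ × ℤ → Bool
  χ (a , b) = colourBy (a ℤ.+ b) (a , b)

  χ-idempotent : ∀ A → χ (+ A , - (+ A)) ≡ F A
  χ-idempotent A = cong (λ i → colourBy i (+ A , - (+ A))) (ℤ.+-inverseʳ (+ A))

  χ-positive : ∀ a b j → a ℤ.+ b ≡ ℤ.+[1+ j ] → χ (a , b) ≡ not (F ℤ.∣ b ℤ.+ + d ∣)
  χ-positive a b j a+b≡1+j = cong (λ i → colourBy i (a , b)) a+b≡1+j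

  -- Let s · t = (n , -n) with s ≠ t in B, so s = (A , -A)
  -- and t = (X , A - n) with X + A = n + e.  If e = 0 then t = (X , -X) and
  -- separation of n by F gives χ s ≠ χ t; if e > 0 then χ t = ¬ F (A + p),
  -- which differs from χ s = F A by p-periodicity.
  avoids-idempotent : ∀ n p → n + p ≡ d → Separates F n → Periodic F p →
    Avoids χ (λ u → u ≡ (+ n , - (+ n)))
  avoids (avoids-idempotent n p n+p≡d separates periodic) s t s∈B t∈B s≢t same st≡n
    with idempotent-factors n s t s∈B t∈B st≡n
  ... | A , X , refl , refl , X≤n with ℕ.m≤n⇒∃[o]m+o≡n (offset-bound X A n (proj₂ t∈B))
  ... | zero , n+0≡X+A = separates A X A+X≡n A≢X
          (trans (sym (χ-idempotent A)) (trans same (trans (cong (λ y → χ (+ X , y)) A-n≡-X) (χ-idempotent X))))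
    where
    A-n≡-X : + A ℤ.- + n ≡ - (+ X)
    A-n≡-X = trans (offset X A n 0 n+0≡X+A) (ℤ.+-identityˡ (- (+ X)))
    A+X≡n : A + X ≡ n
    A+X≡n = trans (ℕ.+-comm A X) (trans (sym n+0≡X+A) (ℕ.+-identityʳ n))
    A≢X : A ≢ X
    A≢X A≡X = s≢t (cong₂ _,_ (cong +_ A≡X) (trans (cong (λ i → - (+ i)) A≡X) (sym A-n≡-X)))
  ... | suc j , n+e≡X+A = not-¬ refl (begin
          F A                                        ≡⟨ sym (χ-idempotent A) ⟩
          χ (+ A , - (+ A))                          ≡⟨ same ⟩
          χ (+ X , + A ℤ.- + n)                      ≡⟨ χ-positive (+ X) (+ A ℤ.- + n) j sum≡e ⟩
          not (F ℤ.∣ + A ℤ.- + n ℤ.+ + d ∣)          ≡⟨ cong (λ i → not (F ℤ.∣ + A ℤ.- + n ℤ.+ + i ∣)) (sym n+p≡d) ⟩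
          not (F ℤ.∣ + A ℤ.- + n ℤ.+ + (n + p) ∣)    ≡⟨ cong (λ i → not (F ℤ.∣ i ∣)) (shift A n p) ⟩
          not (F (A + p))                            ≡⟨ cong not (periodic-at F p periodic (excess⇒positive A X≤n n+e≡X+A)) ⟩
          not (F A)                                  ∎)
    where
    open ≡-Reasoning
    sum≡e : + X ℤ.+ (+ A ℤ.- + n) ≡ ℤ.+[1+ j ]
    sum≡e = trans (cong (λ i → + X ℤ.+ i) (offset X A n (suc j) n+e≡X+A)) (add-sub (+ X) (+ suc j))
      where
      add-sub : ∀ x e → x ℤ.+ (e ℤ.- x) ≡ e
      add-sub = solve-∀

odd⇒positive : ∀ {c} → par c ≡ true → 1 ≤ c
odd⇒positive {suc _} _ = s≤s z≤n

straddle : ∀ {a x m} → a < x → a + x ≡ m + m → a < m × m ≤ x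
straddle {a} {x} {m} a<x a+x≡2m = a<m , m≤x
  where
  a<m : a < m
  a<m = ℕ.≰⇒> λ m≤a → ℕ.<-irrefl (sym a+x≡2m) (ℕ.+-mono-≤-< m≤a (ℕ.≤-<-trans m≤a a<x))
  m≤x : m ≤ x
  m≤x = ℕ.≮⇒≥ λ x<m → ℕ.<-irrefl a+x≡2m (ℕ.+-mono-< (ℕ.<-trans a<x x<m) x<m)

above⇒shift : ∀ {P x} → P < x → Σ ℕ λ i → x ≡ suc i + P
above⇒shift {P} P<x with ℕ.m≤n⇒∃[o]m+o≡n P<x
... | i , 1+P+i≡x = i , trans (sym 1+P+i≡x) (cong suc (ℕ.+-comm P i))

module Construction (k c : ℕ) (c-odd : par c ≡ true) (c≤k : c ≤ k) where

  P : ℕ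
  P = 2 * k ∸ c

  2k≡k+k : 2 * k ≡ k + k
  2k≡k+k = cong (λ n → k + n) (ℕ.+-identityʳ k)

  c+P≡2k : c + P ≡ 2 * k
  c+P≡2k = ℕ.m+[n∸m]≡n (ℕ.≤-trans c≤k (ℕ.m≤m+n k (k + 0)))

  1≤c : 1 ≤ c
  1≤c = odd⇒positive c-odd

  c≤P : c ≤ P
  c≤P = ℕ.≤-trans c≤k (ℕ.+-cancelˡ-≤ c k P
          (subst (c + k ≤_) (trans (sym 2k≡k+k) (sym c+P≡2k)) (ℕ.+-monoˡ-≤ k c≤k)))

  instance
    P-nonZero : NonZero P
    P-nonZero = >-nonZero (ℕ.≤-trans 1≤c c≤P)

  H : ℕ → Bool
  H m = if does (m <? c) then par m else does (m <? k)

  F : ℕ → Bool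
  F zero    = not (H c)
  F (suc m) = H (suc (m % P))

  H-below : ∀ {m} → m < c → H m ≡ par m
  H-below {m} m<c = cong (λ b → if b then par m else does (m <? k)) (dec-true (m <? c) m<c)

  H-above : ∀ {m} → c ≤ m → H m ≡ does (m <? k)
  H-above {m} c≤m = cong (λ b → if b then par m else does (m <? k)) (dec-false (m <? c) (ℕ.≤⇒≯ c≤m))

  F≡H : ∀ {m} → 1 ≤ m → m ≤ P → F m ≡ H m
  F≡H {suc m} _ m<P = cong (λ r → H (suc r)) (m<n⇒m%n≡m m<P)

  F-periodic : Periodic F P
  F-periodic m = cong (λ r → H (suc r)) ([m+n]%n≡m%n m P)

  F0≢Fc : F 0 ≢ F c
  F0≢Fc F0≡Fc = not-¬ refl (sym (trans F0≡Fc (F≡H 1≤c c≤P)))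

  -- Positive numbers summing to c are below c, where F is the parity.
  positive-summands-of-c : ∀ {a x} → 1 ≤ a → 1 ≤ x → a + x ≡ c → F a ≢ F x
  positive-summands-of-c {a} {x} 1≤a 1≤x a+x≡c Fa≡Fx =
    odd-sum-splits a x (subst (λ m → par m ≡ true) (sym a+x≡c) c-odd)
      (trans (sym (F-parity 1≤a a<c)) (trans Fa≡Fx (F-parity 1≤x x<c)))
    where
    a<c : a < c
    a<c = subst (a <_) a+x≡c (ℕ.m<m+n a 1≤x)
    x<c : x < c
    x<c = subst (x <_) a+x≡c (ℕ.m<n+m x 1≤a)
    F-parity : ∀ {m} → 1 ≤ m → m < c → F m ≡ par m
    F-parity 1≤m m<c = trans (F≡H 1≤m (ℕ.≤-trans (ℕ.<⇒≤ m<c) c≤P)) (H-below m<c)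

  -- Sum c: either 0 + c, or two positive summands of different parity.
  separates-c : Separates F c
  separates-c = separates-ordered F c λ where
    zero    x _   x≡c   → subst (λ m → F 0 ≢ F m) (sym x≡c) F0≢Fc
    (suc a) x a<x a+x≡c → positive-summands-of-c (s≤s z≤n) (ℕ.≤-trans (s≤s z≤n) (ℕ.<⇒≤ a<x)) a+x≡c

  -- For a < x with a + x = 2k: if a = 0 then F x = F (c + P) = F c ≠ F 0; if
  -- x ≤ P then c ≤ a < k ≤ x and H tests "below k"; if x = i + P with i ≥ 1
  -- then F x = F i and i + a = c.
  separates-2k : Separates F (2 * k)
  separates-2k = separates-ordered F (2 * k) ordered
    where
    ordered : ∀ a x → a < x → a + x ≡ 2 * k → F a ≢ F x
    ordered zero x _ x≡2k F0≡Fx = F0≢Fc (trans F0≡Fx (trans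
      (cong F (trans x≡2k (sym c+P≡2k))) (periodic-at F P F-periodic 1≤c)))
    ordered (suc a) x a<x a+x≡2k with straddle a<x (trans a+x≡2k 2k≡k+k) | x ≤? P
    ... | a<k , k≤x | yes x≤P = λ Fa≡Fx → true≢false (begin
      true               ≡⟨ sym (dec-true (suc a <? k) a<k) ⟩
      does (suc a <? k)  ≡⟨ sym (trans (F≡H (s≤s z≤n) (ℕ.≤-trans (ℕ.<⇒≤ a<k) k≤P)) (H-above c≤a)) ⟩
      F (suc a)          ≡⟨ Fa≡Fx ⟩
      F x                ≡⟨ trans (F≡H (ℕ.≤-trans (s≤s z≤n) (ℕ.<⇒≤ a<x)) x≤P) (H-above (ℕ.≤-trans c≤k k≤x)) ⟩
      does (x <? k)      ≡⟨ dec-false (x <? k) (ℕ.≤⇒≯ k≤x) ⟩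
      false              ∎)
      where
      open ≡-Reasoning
      true≢false : true ≢ false
      true≢false ()
      k≤P : k ≤ P
      k≤P = ℕ.≤-trans k≤x x≤P
      c≤a : c ≤ suc a
      c≤a = ℕ.+-cancelʳ-≤ P c (suc a)
              (subst (_≤ suc a + P) (trans a+x≡2k (sym c+P≡2k)) (ℕ.+-monoʳ-≤ (suc a) x≤P))
    ... | _ | no x≰P with above⇒shift (ℕ.≰⇒> x≰P)
    ... | i , refl = λ Fa≡Fx → positive-summands-of-c (s≤s z≤n) (s≤s z≤n) i+a≡c
                       (trans (sym (F-periodic i)) (sym Fa≡Fx))
      where
      i+a≡c : suc i + suc a ≡ c
      i+a≡c = ℕ.+-cancelʳ-≡ P (suc i + suc a) c (begin
        suc i + suc a + P     ≡⟨ cong (_+ P) (ℕ.+-comm (suc i) (suc a)) ⟩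
        suc a + suc i + P     ≡⟨ ℕ.+-assoc (suc a) (suc i) P ⟩
        suc a + (suc i + P)   ≡⟨ trans a+x≡2k (sym c+P≡2k) ⟩
        c + P                 ∎)
        where open ≡-Reasoning

  -- When c = k, the period P equals k, so F is also 2k-periodic.
  F-periodic-2k : c ≡ k → Periodic F (2 * k)
  F-periodic-2k c≡k = subst (Periodic F) P+P≡2k (periodic-+ F P P F-periodic F-periodic)
    where
    P≡c : P ≡ c
    P≡c = ℕ.+-cancelˡ-≡ c P c (trans c+P≡2k (trans 2k≡k+k (cong₂ _+_ (sym c≡k) (sym c≡k))))
    P+P≡2k : P + P ≡ 2 * k
    P+P≡2k = trans (cong (_+ P) P≡c) c+P≡2k

-- Both avoidable sets are coloured by lifting the construction with shift 2k:
-- (2k , -2k) uses separation of 2k and period 0, (c , -c) uses separation of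
-- c and period P, and (0 , 0) (when c = k) uses period 2k.

avoidable-pair : ∀ k c → par c ≡ true → c < k →
  Avoidable (λ u → (u ≡ (+ (2 * k) , - (+ (2 * k)))) ⊎ (u ≡ (+ c , - (+ c))))
avoidable-pair k c c-odd c<k = avoidable χ (avoids-∪
  (avoids-idempotent (2 * k) 0 (ℕ.+-identityʳ (2 * k)) separates-2k (periodic-zero F))
  (avoids-idempotent c P c+P≡2k separates-c F-periodic))
  where
  open Construction k c c-odd (ℕ.<⇒≤ c<k)
  open Lift F (2 * k)

avoidable-triple : ∀ k c → par c ≡ true → c ≡ k →
  Avoidable (λ u → (u ≡ (+ (2 * k) , - (+ (2 * k)))) ⊎ ((u ≡ (+ k , - (+ k))) ⊎ (u ≡ (+ 0 , + 0))))
avoidable-triple k .k k-odd refl = avoidable χ (avoids-∪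
  (avoids-idempotent (2 * k) 0 (ℕ.+-identityʳ (2 * k)) separates-2k (periodic-zero F))
  (avoids-∪ (avoids-idempotent k P c+P≡2k separates-c F-periodic)
            (avoids-idempotent 0 (2 * k) refl (separates-zero F) (F-periodic-2k refl))))
  where
  open Construction k k k-odd ℕ.≤-refl
  open Lift F (2 * k)

mainTheorem8 : (k c : ℕ) → 1 ≤ k → (∃ λ m → c ≡ suc (2 * m)) →
    (c < k → Avoidable (λ u → (u ≡ (+ (2 * k) , - (+ (2 * k)))) ⊎ (u ≡ (+ c , - (+ c)))))
    × (c ≡ k → Avoidable (λ u → (u ≡ (+ (2 * k) , - (+ (2 * k)))) ⊎ ((u ≡ (+ k , - (+ k))) ⊎ (u ≡ (+ 0 , + 0)))))
mainTheorem8 k c _ (m , c≡2m+1) = avoidable-pair k c c-odd , avoidable-triple k c c-odd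
  where
  c-odd : par c ≡ true
  c-odd = subst (λ n → par n ≡ true) (sym c≡2m+1) (par-odd m)
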